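{- Let $n\ge2$ and let $\mathscr{A}$ be a closed set of games such that $\mathcal{Q}(\mathscr{A})$ is faithful and is identified with $\mathcal{T}_n$ in such a way that every $X\in\mathscr{A}$ with $\Phi(X)=z_i$ has Grundy value $i$. Let $G\neq0$ be a game all of whose options lie in $\mathscr{A}$. If $\Phi''G$ is complemented, then for every integer $k\ge1$ the sum of $2k$ copies of $G$ is a misère $\mathscr{P}$-position.
   Context: Impartial games: a game is the set of its options; $0=\emptyset$; $G+H$ has options $G'+H$, $G+H'$. Misère play: $G$ is a $\mathscr{P}$-position iff $G\ne0$ and every option is an $\mathscr{N}$-position. A set of games is closed if it contains $0$ and is closed under options and sums. For closed $\mathscr{A}$, $G\equiv_\mathscr{A}H$ iff $G+X$, $H+X$ have the same misère outcome for all $X\in\mathscr{A}$; $\mathcal{Q}(\mathscr{A})=\mathscr{A}/{\equiv_\mathscr{A}}$ with distinguished subset the classes of $\mathscr{P}$-positions, $\Phi$ the quotient map; $\Phi''G=\{\Phi(G'):G'$ an option of $G\}$. $\mathscr{G}$ = Grundy value; faithful means $\Phi(X)=\Phi(Y)\Rightarrow\mathscr{G}(X)=\mathscr{G}(Y)$. $\mathcal{T}_n$ ($n\ge2$) has distinct elements $1,a,z_0,\ldots,z_{2^n-1}$, identity $1$, $a^2=1$, $z_iz_j=z_{i\oplus j}$, $az_i=z_{i\oplus1}$ ($\oplus$ bitwise XOR), distinguished subset $\{a,z_0\}$. Write $z=z_0$ (so $az=z_1$). A subset $\mathcal{E}\subseteq\mathcal{T}_n$ is complemented if $\mathcal{E}\cap\{a,z\}\ne\emptyset$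 and $\mathcal{E}\cap\{1,az\}\ne\emptyset$. -}

module Defs where

open import Data.Nat using (ℕ; zero; suc; _+_; _*_; _≟_)
open import Data.Bool using (Bool; true; false; not; _xor_; if_then_else_)
open import Data.Fin using (Fin; splitAt)
open import Data.Sum using (_⊎_; inj₁; inj₂; [_,_]′)
open import Data.List using (List; []; _∷_; length; tabulate)
open import Data.Bool.ListAction using (all; any)
open import Data.Vec using (Vec; []; _∷_; replicate; zipWith)
open import Data.Product using (Σ; _×_; _,_; ∃)
open import Relation.Binary.PropositionalEquality using (_≡_)
open import Relation.Nullary.Decidable using (⌊_⌋)

data Game : Set where
  mk : (n : ℕ) → (Fin n → Game) → Game

nOpts : Game → ℕ
nOpts (mk n _) = n

opt : (G : Game) → Fin (nOpts G) → Game
opt (mk _ f) i = f i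

zeroG : Game
zeroG = mk 0 (λ ())

IsZero : Game → Set
IsZero G = nOpts G ≡ 0

infixl 6 _⊞_
_⊞_ : Game → Game → Game
mk m f ⊞ mk n g =
  mk (m + n) (λ i → [ (λ i′ → f i′ ⊞ mk n g) , (λ j → mk m f ⊞ g j) ]′ (splitAt m i))

copies : ℕ → Game → Game
copies zero    G = zeroG
copies (suc k) G = G ⊞ copies k G

-- Misère outcome: G is a P-position iff G ≠ 0 and every option is an
-- N-position (i.e. not a P-position).

isP : Game → Bool
isP (mk zero    f) = false
isP (mk (suc n) f) = all (λ i → not (isP (f i))) (tabulate {n = suc n} (λ i → i))

IsP : Game → Set
IsP G = isP G ≡ true

elemℕ : ℕ → List ℕ → Bool
elemℕ k l = any (λ x → ⌊ x ≟ k ⌋) l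

mexFrom : ℕ → ℕ → List ℕ → ℕ
mexFrom zero     k l = k
mexFrom (suc fu) k l = if elemℕ k l then mexFrom fu (suc k) l else k

mex : List ℕ → ℕ
mex l = mexFrom (length l) 0 l

grundy : Game → ℕ
grundy (mk n f) = mex (tabulate (λ i → grundy (f i)))

record Closed (A : Game → Set) : Set where
  field
    has-zero : A zeroG
    opt-closed : ∀ X → A X → ∀ i → A (opt X i)
    sum-closed : ∀ X Y → A X → A Y → A (X ⊞ Y)

_≡[_]_ : Game → (Game → Set) → Game → Set
G ≡[ A ] H = ∀ X → A X → isP (G ⊞ X) ≡ isP (H ⊞ X)

-- The monoid T_n.  The index i ∈ {0,…,2^n-1} of z_i is represented by its
-- n binary digits (least significant digit first), so that bitwise XOR of
-- indices is pointwise xor of digit vectors.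

data T (n : ℕ) : Set where
  one : T n
  a   : T n
  z   : Vec Bool n → T n

bitsVal : ∀ {n} → Vec Bool n → ℕ
bitsVal []       = 0
bitsVal (b ∷ bs) = (if b then 1 else 0) + 2 * bitsVal bs

flip0 : ∀ {n} → Vec Bool n → Vec Bool n
flip0 []       = []
flip0 (b ∷ bs) = not b ∷ bs

bits0 : ∀ n → Vec Bool n
bits0 n = replicate n false

bits1 : ∀ n → Vec Bool n
bits1 zero    = []
bits1 (suc n) = true ∷ replicate n false

infixl 7 _·_
_·_ : ∀ {n} → T n → T n → T n
one · y   = y
a   · one = a
a   · a   = one
a   · z w = z (flip0 w)
z v · one = z v
z v · a   = z (flip0 v)
z v · z w = z (zipWith _xor_ v w)

data Dist {n : ℕ} : T n → Set where
  dist-a  : Dist a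
  dist-z0 : Dist (z (bits0 n))

record IdentifiedWithT (n : ℕ) (A : Game → Set) (Φ : Game → T n) : Set where
  field
    Φ-sound    : ∀ X Y → A X → A Y → Φ X ≡ Φ Y → X ≡[ A ] Y
    Φ-complete : ∀ X Y → A X → A Y → X ≡[ A ] Y → Φ X ≡ Φ Y
    Φ-surj     : ∀ t → Σ Game (λ X → A X × Φ X ≡ t)
    Φ-hom      : ∀ X Y → A X → A Y → Φ (X ⊞ Y) ≡ Φ X · Φ Y
    Φ-dist     : ∀ X → A X → IsP X → Dist (Φ X)
    Φ-dist⁻¹   : ∀ X → A X → Dist (Φ X) → IsP X
    faithful   : ∀ X Y → A X → A Y → Φ X ≡ Φ Y → grundy X ≡ grundy Y
    grundy-z   : ∀ X → A X → (v : Vec Bool n) → Φ X ≡ z v → grundy X ≡ bitsVal v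

-- Φ''G is complemented: it meets {a, z} and meets {1, az} (az = z_1)
Complemented : ∀ {n} → (Φ : Game → T n) → Game → Set
Complemented {n} Φ G =
  (∃ λ i → Φ (opt G i) ≡ a ⊎ Φ (opt G i) ≡ z (bits0 n)) ×
  (∃ λ i → Φ (opt G i) ≡ one ⊎ Φ (opt G i) ≡ z (bits1 n))

-- Let R = {1, z} ⊆ 𝒯ₙ. For X ∈ 𝒜, Φ(X) ∈ R iff 𝒢(X) = 0. By simultaneous induction on k and
-- X, the sum X + (2k+2)·G is a P-position when Φ(X) ∈ R and an N-position when 𝒢(X) ≠ 0.
-- A move to X′ is answered using the induction hypothesis for X′. A move G → G′ in one copy is
-- answered by the same move in another copy when k > 0, reaching (X + 2G′) + 2k·G with
-- Φ(X + 2G′) ∈ R since squares lie in R; when k = 0 it is answered by a move G → G″ with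
-- Φ(X + G′ + G″) ∈ {a, z}, which exists because Φ″G is complemented. Take X = 0.
-- Sums are compared up to reordering of options (_≅_), which preserves misère outcomes.

module Submission where

open import Defs
open import Data.Nat using (ℕ; zero; suc; _+_; _*_; _≤_; _≟_)
open import Data.Nat.Properties using (*-suc; <⇒≤; 0≢1+n; m*n≡0⇒m≡0∨n≡0)
open import Data.Bool using (Bool; true; false; _xor_) renaming (T to IsTrue)
open import Data.Bool.Properties using (T-≡; T-not-≡; ¬-not; not-¬; ⇔→≡; xor-same)
open import Data.Fin using (Fin; splitAt; _↑ˡ_; _↑ʳ_)
open import Data.Fin.Properties using (splitAt-↑ˡ; splitAt-↑ʳ; any?)
open import Data.List using ([]; _∷_; length; tabulate)
import Data.List.Relation.Unary.All.Properties as All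
import Data.List.Relation.Unary.Any.Properties as Any
open import Data.Vec using (Vec; []; _∷_; zipWith)
open import Data.Product using (∃; _×_; _,_; proj₁; proj₂)
open import Data.Sum using (_⊎_; inj₁; inj₂; [_,_]′)
open import Data.Empty using (⊥-elim)
open import Function using (id; _∘_; mk⇔; Equivalence)
open import Relation.Nullary using (¬_; yes; no)
open import Relation.Nullary.Decidable using (fromWitness; toWitness)
open import Relation.Binary using (Setoid)
import Relation.Binary.Reasoning.Setoid as SetoidReasoning
open import Relation.Binary.PropositionalEquality
  using (_≡_; _≢_; refl; sym; trans; cong; cong₂; subst; module ≡-Reasoning)

IsP-nonzero : ∀ G → IsP G → Fin (nOpts G)
IsP-nonzero (mk (suc n) f) _ = Data.Fin.zero

IsP-options : ∀ G → IsP G → ∀ i → ¬ IsP (opt G i)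
IsP-options (mk (suc n) f) p i =
  not-¬ (Equivalence.to T-not-≡ (All.tabulate⁻ {f = id} (All.all⁺ _ _ (Equivalence.from T-≡ p)) i))

IsP-intro : ∀ G → Fin (nOpts G) → (∀ i → ¬ IsP (opt G i)) → IsP G
IsP-intro (mk (suc n) f) _ h =
  Equivalence.to T-≡ (All.all⁻ _ (All.tabulate⁺ {f = id} (λ i → Equivalence.from T-not-≡ (¬-not (h i)))))

infix 4 _⟶_
record _⟶_ (G H : Game) : Set where
  constructor move
  field
    index   : Fin (nOpts G)
    reaches : opt G index ≡ H

option : ∀ G i → G ⟶ opt G i
option G i = move i refl

¬IsP-move : ∀ {G H} → G ⟶ H → IsP H → ¬ IsP G
¬IsP-move {G} (move i refl) q p = IsP-options G p i q

mexFrom-suc≢0 : ∀ fuel k l → mexFrom fuel (suc k) l ≢ 0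
mexFrom-suc≢0 zero       k l ()
mexFrom-suc≢0 (suc fuel) k l with elemℕ (suc k) l
... | true  = mexFrom-suc≢0 fuel (suc k) l
... | false = λ ()

mex≡0⇒0∉ : ∀ l → mex l ≡ 0 → ¬ IsTrue (elemℕ 0 l)
mex≡0⇒0∉ (x ∷ l) e with elemℕ 0 (x ∷ l)
... | true  = ⊥-elim (mexFrom-suc≢0 (length l) 0 (x ∷ l) e)
... | false = λ ()

0∉⇒mex≡0 : ∀ l → ¬ IsTrue (elemℕ 0 l) → mex l ≡ 0
0∉⇒mex≡0 []      _ = refl
0∉⇒mex≡0 (x ∷ l) h with elemℕ 0 (x ∷ l)
... | true  = ⊥-elim (h _)
... | false = refl

elemℕ-tabulate⁺ : ∀ {n k} (g : Fin n → ℕ) i → g i ≡ k → IsTrue (elemℕ k (tabulate g))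
elemℕ-tabulate⁺ g i e = Any.any⁺ _ (Any.tabulate⁺ i (fromWitness e))

elemℕ-tabulate⁻ : ∀ {n k} (g : Fin n → ℕ) → IsTrue (elemℕ k (tabulate g)) → ∃ λ i → g i ≡ k
elemℕ-tabulate⁻ g t with Any.tabulate⁻ (Any.any⁻ _ _ t)
... | i , w = i , toWitness w

grundy≡0⇒options≢0 : ∀ G → grundy G ≡ 0 → ∀ i → grundy (opt G i) ≢ 0
grundy≡0⇒options≢0 (mk n f) e i gi =
  mex≡0⇒0∉ (tabulate (grundy ∘ f)) e (elemℕ-tabulate⁺ (grundy ∘ f) i gi)

options≢0⇒grundy≡0 : ∀ G → (∀ i → grundy (opt G i) ≢ 0) → grundy G ≡ 0
options≢0⇒grundy≡0 (mk n f) h =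
  0∉⇒mex≡0 (tabulate (grundy ∘ f)) (λ t → let i , e = elemℕ-tabulate⁻ (grundy ∘ f) t in h i e)

grundy≢0⇒option≡0 : ∀ G → grundy G ≢ 0 → ∃ λ i → grundy (opt G i) ≡ 0
grundy≢0⇒option≡0 G g≢0 with any? (λ i → grundy (opt G i) ≟ 0)
... | yes p = p
... | no ¬p = ⊥-elim (g≢0 (options≢0⇒grundy≡0 G (λ i e → ¬p (i , e))))

grundy≢0-move : ∀ {G H} → G ⟶ H → grundy H ≡ 0 → grundy G ≢ 0
grundy≢0-move {G} (move i refl) gH gG = grundy≡0⇒options≢0 G gG i gH

⊞-moveˡ : ∀ {G G′ H} → G ⟶ G′ → G ⊞ H ⟶ G′ ⊞ H
⊞-moveˡ {mk m f} {H = mk n g} (move i refl) = move (i ↑ˡ n) (cong [ _ , _ ]′ (splitAt-↑ˡ m i n))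

⊞-moveʳ : ∀ {G H H′} → H ⟶ H′ → G ⊞ H ⟶ G ⊞ H′
⊞-moveʳ {mk m f} {mk n g} (move j refl) = move (m ↑ʳ j) (cong [ _ , _ ]′ (splitAt-↑ʳ m n j))

⊞-option-elim : ∀ (P : Game → Set) {G H} →
  (∀ i → P (opt G i ⊞ H)) → (∀ j → P (G ⊞ opt H j)) → ∀ k → P (opt (G ⊞ H) k)
⊞-option-elim P {mk m f} {mk n g} left right k with splitAt m k
... | inj₁ i = left i
... | inj₂ j = right j

grundy-⊞-zero : ∀ G H → grundy G ≡ 0 → grundy H ≡ 0 → grundy (G ⊞ H) ≡ 0
grundy-⊞-nonzeroˡ : ∀ G H → grundy G ≢ 0 → grundy H ≡ 0 → grundy (G ⊞ H) ≢ 0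
grundy-⊞-nonzeroʳ : ∀ G H → grundy G ≡ 0 → grundy H ≢ 0 → grundy (G ⊞ H) ≢ 0

grundy-⊞-zero G@(mk _ f) H@(mk _ g) gG gH =
  options≢0⇒grundy≡0 (G ⊞ H) (⊞-option-elim (λ X → grundy X ≢ 0) {G} {H}
  (λ i → grundy-⊞-nonzeroˡ (f i) H (grundy≡0⇒options≢0 G gG i) gH)
  (λ j → grundy-⊞-nonzeroʳ G (g j) gG (grundy≡0⇒options≢0 H gH j)))
grundy-⊞-nonzeroˡ G@(mk _ f) H gG gH =
  let i , gGᵢ = grundy≢0⇒option≡0 G gG in
  grundy≢0-move (⊞-moveˡ (option G i)) (grundy-⊞-zero (f i) H gGᵢ gH)
grundy-⊞-nonzeroʳ G H@(mk _ g) gG gH =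
  let j , gHⱼ = grundy≢0⇒option≡0 H gH in
  grundy≢0-move (⊞-moveʳ {G} (option H j)) (grundy-⊞-zero G (g j) gG gHⱼ)

infix 4 _≅_
data _≅_ : Game → Game → Set where
  iso : ∀ {G H} → (∀ i → ∃ λ j → opt G i ≅ opt H j) → (∀ j → ∃ λ i → opt H j ≅ opt G i) → G ≅ H

≅-refl : ∀ {G} → G ≅ G
≅-refl {mk n f} = iso (λ i → i , ≅-refl {f i}) (λ i → i , ≅-refl {f i})

≅-sym : ∀ {G H} → G ≅ H → H ≅ G
≅-sym (iso forth back) = iso back forth

≅-trans : ∀ {G H K} → G ≅ H → H ≅ K → G ≅ K
≅-trans (iso forth₁ back₁) (iso forth₂ back₂) =
  iso (λ i → let j , p = forth₁ i ; k , q = forth₂ j in k , ≅-trans p q)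
      (λ k → let j , q = back₂ k ; i , p = back₁ j in i , ≅-trans q p)

≅-setoid : Setoid _ _
≅-setoid = record
  { Carrier       = Game
  ; _≈_           = _≅_
  ; isEquivalence = record { refl = ≅-refl ; sym = ≅-sym ; trans = ≅-trans }
  }

IsP-≅ : ∀ {G H} → G ≅ H → IsP G → IsP H
IsP-≅ {G} {H} (iso forth back) p =
  IsP-intro H (proj₁ (forth (IsP-nonzero G p))) (λ j q → let i , r = back j in IsP-options G p i (IsP-≅ r q))

isP-≅ : ∀ {G H} → G ≅ H → isP G ≡ isP H
isP-≅ p = ⇔→≡ (mk⇔ (IsP-≅ p) (IsP-≅ (≅-sym p)))

IsoToOptionOf : Game → Game → Set
IsoToOptionOf G X = ∃ λ j → X ≅ opt G j

reach : ∀ {G X Y} → G ⟶ Y → X ≅ Y → IsoToOptionOf G X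
reach (move j refl) p = j , p

⊞-cong : ∀ {G G′ H H′} → G ≅ G′ → H ≅ H′ → G ⊞ H ≅ G′ ⊞ H′
⊞-cong {G@(mk _ f)} {G′@(mk _ f′)} {H@(mk _ g)} {H′@(mk _ g′)} p@(iso α β) q@(iso γ δ) = iso
  (⊞-option-elim (IsoToOptionOf (G′ ⊞ H′))
    (λ i → let j , r = α i in reach (⊞-moveˡ (option G′ j)) (⊞-cong {f i} {f′ j} {H} {H′} r q))
    (λ i → let j , r = γ i in reach (⊞-moveʳ (option H′ j)) (⊞-cong {G} {G′} {g i} {g′ j} p r)))
  (⊞-option-elim (IsoToOptionOf (G ⊞ H))
    (λ j → let i , r = β j in reach (⊞-moveˡ (option G i)) (⊞-cong {f′ j} {f i} {H′} {H} r (≅-sym q)))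
    (λ j → let i , r = δ j in reach (⊞-moveʳ (option H i)) (⊞-cong {G′} {G} {g′ j} {g i} (≅-sym p) r)))

⊞-comm : ∀ G H → G ⊞ H ≅ H ⊞ G
⊞-comm G@(mk _ f) H@(mk _ g) = iso
  (⊞-option-elim (IsoToOptionOf (H ⊞ G))
    (λ i → reach (⊞-moveʳ (option G i)) (⊞-comm (f i) H))
    (λ j → reach (⊞-moveˡ (option H j)) (⊞-comm G (g j))))
  (⊞-option-elim (IsoToOptionOf (G ⊞ H))
    (λ j → reach (⊞-moveʳ (option H j)) (⊞-comm (g j) G))
    (λ i → reach (⊞-moveˡ (option G i)) (⊞-comm H (f i))))

⊞-assoc : ∀ G H K → (G ⊞ H) ⊞ K ≅ G ⊞ (H ⊞ K)
⊞-assoc G@(mk _ f) H@(mk _ g) K@(mk _ h) = iso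
  (⊞-option-elim (IsoToOptionOf (G ⊞ (H ⊞ K)))
    (⊞-option-elim (λ X → IsoToOptionOf (G ⊞ (H ⊞ K)) (X ⊞ K))
      (λ i → reach (⊞-moveˡ (option G i)) (⊞-assoc (f i) H K))
      (λ j → reach (⊞-moveʳ (⊞-moveˡ (option H j))) (⊞-assoc G (g j) K)))
    (λ l → reach (⊞-moveʳ (⊞-moveʳ (option K l))) (⊞-assoc G H (h l))))
  (⊞-option-elim (IsoToOptionOf ((G ⊞ H) ⊞ K))
    (λ i → reach (⊞-moveˡ (⊞-moveˡ (option G i))) (≅-sym (⊞-assoc (f i) H K)))
    (⊞-option-elim (λ X → IsoToOptionOf ((G ⊞ H) ⊞ K) (G ⊞ X))
      (λ j → reach (⊞-moveˡ (⊞-moveʳ (option H j))) (≅-sym (⊞-assoc G (g j) K)))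
      (λ l → reach (⊞-moveʳ (option K l)) (≅-sym (⊞-assoc G H (h l))))))

⊞-identityʳ : ∀ G → G ⊞ zeroG ≅ G
⊞-identityʳ G@(mk _ f) = iso
  (⊞-option-elim (IsoToOptionOf G) (λ i → reach (option G i) (⊞-identityʳ (f i))) (λ ()))
  (λ i → reach (⊞-moveˡ (option G i)) (≅-sym (⊞-identityʳ (f i))))

⊞-identityˡ : ∀ G → zeroG ⊞ G ≅ G
⊞-identityˡ G = ≅-trans (⊞-comm zeroG G) (⊞-identityʳ G)

⊞-swap : ∀ G H K → G ⊞ (H ⊞ K) ≅ H ⊞ (G ⊞ K)
⊞-swap G H K = begin
  G ⊞ (H ⊞ K)  ≈⟨ ≅-sym (⊞-assoc G H K) ⟩
  (G ⊞ H) ⊞ K  ≈⟨ ⊞-cong (⊞-comm G H) ≅-refl ⟩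
  (H ⊞ G) ⊞ K  ≈⟨ ⊞-assoc H G K ⟩
  H ⊞ (G ⊞ K)  ∎
  where open SetoidReasoning ≅-setoid

copies-option : ∀ G m r → ∃ λ i → opt (copies (suc m) G) r ≅ opt G i ⊞ copies m G
copies-option G zero = ⊞-option-elim (λ X → ∃ λ i → X ≅ opt G i ⊞ zeroG) {G} (λ i → i , ≅-refl) λ ()
copies-option G (suc m) = ⊞-option-elim (λ X → ∃ λ i → X ≅ opt G i ⊞ copies (suc m) G) (λ i → i , ≅-refl)
  λ j → let i , p = copies-option G m j in i , ≅-trans (⊞-cong ≅-refl p) (⊞-swap G (opt G i) (copies m G))

Grundy0 : ∀ {n} → T n → Set
Grundy0 {n} t = t ≡ one ⊎ t ≡ z (bits0 n)

xor-self : ∀ {n} (v : Vec Bool n) → zipWith _xor_ v v ≡ bits0 n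
xor-self []      = refl
xor-self (b ∷ v) = cong₂ _∷_ (xor-same b) (xor-self v)

flip0-bits0 : ∀ n → flip0 (bits0 n) ≡ bits1 n
flip0-bits0 zero    = refl
flip0-bits0 (suc n) = refl

flip0-bits1 : ∀ n → flip0 (bits1 n) ≡ bits0 n
flip0-bits1 zero    = refl
flip0-bits1 (suc n) = refl

bitsVal-bits0 : ∀ n → bitsVal (bits0 n) ≡ 0
bitsVal-bits0 zero    = refl
bitsVal-bits0 (suc n) = cong (2 *_) (bitsVal-bits0 n)

bitsVal-bits1 : ∀ {n} → 1 ≤ n → bitsVal (bits1 n) ≡ 1
bitsVal-bits1 {suc n} _ = cong (λ x → suc (2 * x)) (bitsVal-bits0 n)

bitsVal≡0⇒bits0 : ∀ {n} (v : Vec Bool n) → bitsVal v ≡ 0 → v ≡ bits0 n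
bitsVal≡0⇒bits0 []           _ = refl
bitsVal≡0⇒bits0 (false ∷ bs) e = cong (false ∷_) (bitsVal≡0⇒bits0 bs ([ (λ ()) , id ]′ (m*n≡0⇒m≡0∨n≡0 2 e)))
bitsVal≡0⇒bits0 (true  ∷ bs) ()

·-identityʳ : ∀ {n} (t : T n) → t · one ≡ t
·-identityʳ one   = refl
·-identityʳ a     = refl
·-identityʳ (z v) = refl

Grundy0-square : ∀ {n} (t : T n) → Grundy0 (t · t)
Grundy0-square one   = inj₁ refl
Grundy0-square a     = inj₁ refl
Grundy0-square (z v) = inj₂ (cong z (xor-self v))

Grundy0-· : ∀ {n} {s u : T n} → Grundy0 s → Grundy0 u → Grundy0 (s · u)
Grundy0-· (inj₁ refl) gu          = gu
Grundy0-· (inj₂ refl) (inj₁ refl) = inj₂ refl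
Grundy0-· (inj₂ refl) (inj₂ refl) = inj₂ (cong z (xor-self _))

Dist-·z0 : ∀ {n} {s : T n} → Grundy0 s → Dist (s · z (bits0 n))
Dist-·z0 (inj₁ refl) = dist-z0
Dist-·z0 (inj₂ refl) = subst (Dist ∘ z) (sym (xor-self _)) dist-z0

ComplementedSet : ∀ {n} → (T n → Set) → Set
ComplementedSet {n} E =
  (∃ λ u → E u × (u ≡ a ⊎ u ≡ z (bits0 n))) × (∃ λ u → E u × (u ≡ one ⊎ u ≡ z (bits1 n)))

complemented-reply : ∀ {n} {E : T n → Set} → ComplementedSet E →
  ∀ {s t} → Grundy0 s → E t → ∃ λ u → E u × Dist (s · (t · u))
complemented-reply _ {s} {z v} gs Et =
  z v , Et , subst (λ w → Dist (s · z w)) (sym (xor-self v)) (Dist-·z0 gs)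
complemented-reply ((u , Eu , inj₁ refl) , _) {t = one} (inj₁ refl) _ = u , Eu , dist-a
complemented-reply ((u , Eu , inj₂ refl) , _) {t = one} (inj₁ refl) _ = u , Eu , dist-z0
complemented-reply _ {t = one} (inj₂ refl) Et = one , Et , dist-z0
complemented-reply (_ , (u , Eu , inj₁ refl)) {t = a} (inj₁ refl) _ = u , Eu , dist-a
complemented-reply {n} (_ , (u , Eu , inj₂ refl)) {t = a} (inj₁ refl) _ =
  u , Eu , subst (Dist ∘ z) (sym (flip0-bits1 n)) dist-z0
complemented-reply _ {t = a} (inj₂ refl) Et = a , Et , dist-z0

module Identified {n} (1≤n : 1 ≤ n) {A : Game → Set} (closed : Closed A)
                  {Φ : Game → T n} (identified : IdentifiedWithT n A Φ) where

  open Closed closed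
  open IdentifiedWithT identified

  Φ-zero : Φ zeroG ≡ one
  Φ-zero = begin
    Φ zeroG          ≡⟨ sym (·-identityʳ _) ⟩
    Φ zeroG · one    ≡⟨ cong (Φ zeroG ·_) (sym ΦY≡one) ⟩
    Φ zeroG · Φ Y    ≡⟨ sym (Φ-hom zeroG Y has-zero AY) ⟩
    Φ (zeroG ⊞ Y)    ≡⟨ Φ-complete _ Y (sum-closed _ Y has-zero AY) AY 0⊞Y≡Y ⟩
    Φ Y              ≡⟨ ΦY≡one ⟩
    one              ∎
    where
    open ≡-Reasoning
    Y = proj₁ (Φ-surj one)
    AY = proj₁ (proj₂ (Φ-surj one))
    ΦY≡one = proj₂ (proj₂ (Φ-surj one))
    0⊞Y≡Y : (zeroG ⊞ Y) ≡[ A ] Y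
    0⊞Y≡Y X _ = isP-≅ (⊞-cong (⊞-identityˡ Y) ≅-refl)

  Φ-hom₃ : ∀ {X Y Z} → A X → A Y → A Z → Φ (X ⊞ (Y ⊞ Z)) ≡ Φ X · (Φ Y · Φ Z)
  Φ-hom₃ {X} {Y} {Z} AX AY AZ =
    trans (Φ-hom X (Y ⊞ Z) AX (sum-closed Y Z AY AZ)) (cong (Φ X ·_) (Φ-hom Y Z AY AZ))

  Grundy0⇒grundy≡0 : ∀ {X} → A X → Grundy0 (Φ X) → grundy X ≡ 0
  Grundy0⇒grundy≡0 {X} AX (inj₁ ΦX≡one) = faithful X zeroG AX has-zero (trans ΦX≡one (sym Φ-zero))
  Grundy0⇒grundy≡0 {X} AX (inj₂ ΦX≡z)   = trans (grundy-z X AX _ ΦX≡z) (bitsVal-bits0 n)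

  -- X ⊞ Z has Grundy value 0 ⊕ 0 = 0, but lies in the class a · z = z₁, of Grundy value 1.
  grundy≢0-of-a : ∀ {X} → A X → Φ X ≡ a → grundy X ≢ 0
  grundy≢0-of-a {X} AX ΦX≡a gX = 0≢1+n (begin
    0                     ≡⟨ sym (grundy-⊞-zero X Z gX gZ) ⟩
    grundy (X ⊞ Z)        ≡⟨ grundy-z (X ⊞ Z) (sum-closed X Z AX AZ) (bits1 n) Φ[X⊞Z] ⟩
    bitsVal (bits1 n)     ≡⟨ bitsVal-bits1 1≤n ⟩
    1                     ∎)
    where
    open ≡-Reasoning
    Z = proj₁ (Φ-surj (z (bits0 n)))
    AZ = proj₁ (proj₂ (Φ-surj (z (bits0 n))))
    ΦZ≡z = proj₂ (proj₂ (Φ-surj (z (bits0 n))))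
    gZ = Grundy0⇒grundy≡0 AZ (inj₂ ΦZ≡z)
    Φ[X⊞Z] : Φ (X ⊞ Z) ≡ z (bits1 n)
    Φ[X⊞Z] = trans (Φ-hom X Z AX AZ) (trans (cong₂ _·_ ΦX≡a ΦZ≡z) (cong z (flip0-bits0 n)))

  grundy≡0⇒Grundy0 : ∀ {X} → A X → grundy X ≡ 0 → Grundy0 (Φ X)
  grundy≡0⇒Grundy0 {X} AX gX with Φ X in ΦX≡
  ... | one = inj₁ refl
  ... | a   = ⊥-elim (grundy≢0-of-a AX ΦX≡ gX)
  ... | z v = inj₂ (cong z (bitsVal≡0⇒bits0 v (trans (sym (grundy-z X AX v ΦX≡)) gX)))

  Dist⇒IsP : ∀ {X Y Z} → A X → A Y → A Z → Dist (Φ X · (Φ Y · Φ Z)) → IsP (X ⊞ (Y ⊞ Z))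
  Dist⇒IsP {X} {Y} {Z} AX AY AZ d =
    Φ-dist⁻¹ (X ⊞ (Y ⊞ Z)) (sum-closed X _ AX (sum-closed Y Z AY AZ))
             (subst Dist (sym (Φ-hom₃ AX AY AZ)) d)

  module EvenCopies {G : Game} (A-options : ∀ i → A (opt G i)) (complemented : Complemented Φ G) where

    OptionClass : T n → Set
    OptionClass u = ∃ λ i → Φ (opt G i) ≡ u

    option-classes-complemented : ComplementedSet OptionClass
    option-classes-complemented =
      let (i , p) , (j , q) = complemented in (_ , (i , refl) , p) , (_ , (j , refl) , q)

    P-position : ∀ k {X} → A X → Grundy0 (Φ X) → IsP (X ⊞ copies (2 + 2 * k) G)
    N-position : ∀ k {X} → A X → grundy X ≢ 0 → ¬ IsP (X ⊞ copies (2 + 2 * k) G)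
    reply : ∀ k {X} → A X → Grundy0 (Φ X) → ∀ i →
            ∃ λ h → IsP (X ⊞ (opt G i ⊞ (opt G h ⊞ copies (2 * k) G)))

    P-position k {X@(mk _ f)} AX gX =
      IsP-intro (X ⊞ copies (2 + 2 * k) G) (_⟶_.index some-move)
        (⊞-option-elim (¬_ ∘ IsP) {X} {copies (2 + 2 * k) G} left right)
      where
      some-move : X ⊞ copies (2 + 2 * k) G ⟶ X ⊞ (opt G _ ⊞ copies (1 + 2 * k) G)
      some-move = ⊞-moveʳ {X} (⊞-moveˡ (option G (proj₁ (proj₁ complemented))))
      left : ∀ i → ¬ IsP (f i ⊞ copies (2 + 2 * k) G)
      left i = N-position k {f i} (opt-closed X AX i)
                 (grundy≡0⇒options≢0 X (Grundy0⇒grundy≡0 AX gX) i)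
      right : ∀ r → ¬ IsP (X ⊞ opt (copies (2 + 2 * k) G) r)
      right r = ¬IsP-move answer p ∘ IsP-≅ moved
        where
        i = proj₁ (copies-option G (1 + 2 * k) r)
        h = proj₁ (reply k AX gX i)
        p = proj₂ (reply k AX gX i)
        moved : X ⊞ opt (copies (2 + 2 * k) G) r ≅ X ⊞ (opt G i ⊞ copies (1 + 2 * k) G)
        moved = ⊞-cong ≅-refl (proj₂ (copies-option G (1 + 2 * k) r))
        answer : X ⊞ (opt G i ⊞ copies (1 + 2 * k) G) ⟶ X ⊞ (opt G i ⊞ (opt G h ⊞ copies (2 * k) G))
        answer = ⊞-moveʳ {X} (⊞-moveʳ (⊞-moveˡ (option G h)))

    N-position k {X@(mk _ f)} AX gX =
      let i , gXᵢ = grundy≢0⇒option≡0 X gX ; AXᵢ = opt-closed X AX i in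
      ¬IsP-move (⊞-moveˡ (option X i)) (P-position k {f i} AXᵢ (grundy≡0⇒Grundy0 AXᵢ gXᵢ))

    reply zero {X} AX gX i with complemented-reply option-classes-complemented gX (i , refl)
    ... | _ , (h , refl) , d = h , IsP-≅ pad (Dist⇒IsP AX (A-options i) (A-options h) d)
      where
      pad : X ⊞ (opt G i ⊞ opt G h) ≅ X ⊞ (opt G i ⊞ (opt G h ⊞ zeroG))
      pad = ⊞-cong ≅-refl (⊞-cong ≅-refl (≅-sym (⊞-identityʳ (opt G h))))
    reply (suc k) {X} AX gX i = i , IsP-≅ regroup (P-position k AXGG gXGG)
      where
      Gᵢ = opt G i
      XGG = X ⊞ (Gᵢ ⊞ Gᵢ)
      AXGG : A XGG
      AXGG = sum-closed X _ AX (sum-closed Gᵢ Gᵢ (A-options i) (A-options i))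
      gXGG : Grundy0 (Φ XGG)
      gXGG = subst Grundy0 (sym (Φ-hom₃ AX (A-options i) (A-options i)))
                   (Grundy0-· gX (Grundy0-square (Φ Gᵢ)))
      regroup : XGG ⊞ copies (2 + 2 * k) G ≅ X ⊞ (Gᵢ ⊞ (Gᵢ ⊞ copies (2 * suc k) G))
      regroup = begin
        XGG ⊞ copies (2 + 2 * k) G              ≡⟨ cong (λ m → XGG ⊞ copies m G) (sym (*-suc 2 k)) ⟩
        XGG ⊞ copies (2 * suc k) G              ≈⟨ ⊞-assoc X (Gᵢ ⊞ Gᵢ) _ ⟩
        X ⊞ ((Gᵢ ⊞ Gᵢ) ⊞ copies (2 * suc k) G)  ≈⟨ ⊞-cong ≅-refl (⊞-assoc Gᵢ Gᵢ _) ⟩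
        X ⊞ (Gᵢ ⊞ (Gᵢ ⊞ copies (2 * suc k) G))  ∎
        where open SetoidReasoning ≅-setoid

lemma4p4 : (n : ℕ) → 2 ≤ n →
    (A : Game → Set) → Closed A →
    (Φ : Game → T n) → IdentifiedWithT n A Φ →
    (G : Game) → ¬ IsZero G → (∀ i → A (opt G i)) →
    Complemented Φ G →
    ∀ k → 1 ≤ k → IsP (copies (2 * k) G)
lemma4p4 _ _ _ _ _ _ _ _ _ _ zero ()
lemma4p4 n 2≤n A closed Φ identified G _ A-options complemented (suc k) _ =
  subst IsP (cong (λ m → copies m G) (sym (*-suc 2 k)))
    (IsP-≅ (⊞-identityˡ (copies (2 + 2 * k) G)) (P-position k (Closed.has-zero closed) (inj₁ Φ-zero)))
  where
  open Identified (<⇒≤ 2≤n) closed identified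
  open EvenCopies {G} A-options complemented
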